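{- Let $d\geq 0$ and let $S=(V,\mathcal{H})$ be a paving simplicial complex of dimension $d$. Then $L(S^{\varepsilon})=\varepsilon(S)$.
   Context: A (finite) simplicial complex is a pair $S=(V,\mathcal{H})$ where $V$ is a finite nonempty set and $\mathcal{H}\subseteq 2^V$ contains all singletons and is closed under taking subsets. Its dimension is $\max\{|I|:I\in\mathcal{H}\}-1$. $P_n(V)$ (resp. $P_{\leq n}(V)$) is the set of subsets of $V$ of size exactly (resp. at most) $n$. $S$ is paving if $P_{\dim S}(V)\subseteq\mathcal{H}$. A flat of a simplicial complex $(V,\mathcal{J})$ is $X\subseteq V$ with $I\cup\{p\}\in\mathcal{J}$ for all $I\in\mathcal{J}\cap 2^X$ and $p\in V\setminus X$; $L(\cdot)$ denotes the set of flats. For a family $\mathcal{F}\subseteq 2^V$ containing $V$ and closed under intersection, $\mathrm{Tr}(\mathcal{F})$ is the set of $X\subseteq V$ admitting an enumeration $x_1,\dots,x_k$ and a chain $F_0\subset F_1\subset\cdots\subset F_k$ in $\mathcal{F}$ with $x_i\in F_i\setminus F_{i-1}$. For $S$ of dimension $d$, $\varepsilon(S)=\{X\subseteq V : \forall Y\in\mathcal{H}\cap P_{\leq d}(X)\ \forall p\in V\setminus X,\ Y\cup\{p\}\in\mathcal{H}\}$ (a family containing $V$ and closed under intersection), and $S^{\varepsilon}=(V,\mathrm{Tr}(\varepsilon(S)))$. -}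

module Defs where

open import Level using (0ℓ)
open import Data.Nat using (ℕ; suc; _≤_)
open import Data.Fin using (Fin; inject₁) renaming (suc to fsuc)
open import Data.Fin.Subset using (Subset; _∈_; _∉_; _⊆_; _⊂_; _∪_; ⁅_⁆; ∣_∣)
open import Data.Product using (Σ; ∃; _×_; _,_)
open import Function.Definitions using (Injective)
open import Relation.Binary.PropositionalEquality using (_≡_)
open import Function.Bundles using (_⇔_)

Family : ℕ → Set₁
Family n = Subset n → Set

record SimplicialComplex (m : ℕ) : Set₁ where
  field
    H         : Family (suc m)
    singleton : ∀ (v : Fin (suc m)) → H ⁅ v ⁆
    downClosed : ∀ {I J : Subset (suc m)} → J ⊆ I → H I → H J
open SimplicialComplex public

-- dim S = d  :  max { |I| : I ∈ H } - 1 = d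
HasDimension : ∀ {m} → SimplicialComplex m → ℕ → Set
HasDimension S d =
  (Σ (Subset _) λ I → H S I × ∣ I ∣ ≡ suc d)
  × (∀ I → H S I → ∣ I ∣ ≤ suc d)

IsPaving : ∀ {m} → SimplicialComplex m → ℕ → Set
IsPaving S d = ∀ (I : Subset _) → ∣ I ∣ ≡ d → H S I

IsFlat : ∀ {n} → Family n → Subset n → Set
IsFlat J X = ∀ (I : Subset _) → J I → I ⊆ X → ∀ p → p ∉ X → J (I ∪ ⁅ p ⁆)

-- Tr(F): X admits an enumeration x_1..x_k (an injective map Fin k → V with image X)
-- and a chain F_0 ⊂ F_1 ⊂ ... ⊂ F_k in F with x_i ∈ F_i \ F_{i-1}.
-- Index conventions: x_i is  x i  (i : Fin k, 0-based), F_j is  F j  (j : Fin (suc k)),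
-- so F_{i-1} = F (inject₁ i) and F_i = F (fsuc i).
Tr : ∀ {n} → Family n → Family n
Tr {n} ℱ X =
  Σ ℕ λ k →
  Σ (Fin k → Fin n) λ x →
  Σ (Fin (suc k) → Subset n) λ F →
    Injective _≡_ _≡_ x
    × (∀ y → y ∈ X → ∃ λ i → x i ≡ y)
    × (∀ i → x i ∈ X)
    × (∀ j → ℱ (F j))
    × (∀ i → F (inject₁ i) ⊂ F (fsuc i))
    × (∀ i → x i ∈ F (fsuc i) × x i ∉ F (inject₁ i))

ε : ∀ {m} → SimplicialComplex m → ℕ → Family (suc m)
ε S d X = ∀ (Y : Subset _) → H S Y → Y ⊆ X → ∣ Y ∣ ≤ d → ∀ p → p ∉ X → H S (Y ∪ ⁅ p ⁆)

-- the complex S^ε = (V, Tr(ε(S))), given by its family of faces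
Hε : ∀ {m} → SimplicialComplex m → ℕ → Family (suc m)
Hε S d = Tr (ε S d)

-- Members of a family ℱ that contains V and is closed under ∩ are flats of Tr ℱ,
-- since a chain for I ⊆ X, cut down to X and capped by V, is a chain for I ∪ {p}.
-- Conversely, as S is paving, every set of size ≤ d is a face, so every set of size < d
-- lies in ε(S) and every set of size ≤ d lies in Tr ε(S). For a flat X of S^ε, a face
-- Y ⊆ X of size ≤ d and p ∉ X, the set T = Y ∪ {p} then lies in Tr ε(S); its last
-- element x avoids a member G of ε(S) containing T - x, a face of size ≤ d, so T is a face.

module Submission where

open import Defs
open import Data.Nat using (ℕ; zero; suc; _≤_; _<_; _≤?_; s≤s)
open import Data.Nat.Properties using (≤-refl; ≤-trans; ≤-antisym; ≤-pred; <-≤-trans; n≤1+n; n≮0; ≰⇒>)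
open import Data.Fin using (Fin; fromℕ; inject₁; _≟_) renaming (zero to fzero; suc to fsuc)
open import Data.Fin.Relation.Unary.Top using (view; ‵fromℕ; ‵inject₁)
open import Data.Fin.Subset
open import Data.Fin.Subset.Properties
open import Data.Vec using (_∷_; []; there)
open import Data.Product using (∃; ∃₂; _×_; _,_; proj₁; proj₂)
open import Data.Sum using (inj₁; inj₂)
open import Data.Empty using (⊥-elim)
open import Function using (_∘_; id)
open import Relation.Nullary using (yes; no)
open import Relation.Binary.PropositionalEquality using (_≡_; _≢_; refl; sym; trans; cong; subst)
open import Function.Bundles using (_⇔_; mk⇔)

_∷ʳ_ : ∀ {k} {A : Set} → (Fin k → A) → A → Fin (suc k) → A
_∷ʳ_ {zero}  f a fzero    = a
_∷ʳ_ {suc k} f a fzero    = f fzero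
_∷ʳ_ {suc k} f a (fsuc i) = ((f ∘ fsuc) ∷ʳ a) i

∷ʳ-fromℕ : ∀ {k} {A : Set} (f : Fin k → A) a → (f ∷ʳ a) (fromℕ k) ≡ a
∷ʳ-fromℕ {zero}  f a = refl
∷ʳ-fromℕ {suc k} f a = ∷ʳ-fromℕ (f ∘ fsuc) a

∷ʳ-inject₁ : ∀ {k} {A : Set} (f : Fin k → A) a i → (f ∷ʳ a) (inject₁ i) ≡ f i
∷ʳ-inject₁ {suc k} f a fzero    = refl
∷ʳ-inject₁ {suc k} f a (fsuc i) = ∷ʳ-inject₁ (f ∘ fsuc) a i

⊆-fromℕ : ∀ {n k} (G : Fin (suc k) → Subset n) → (∀ i → G (inject₁ i) ⊆ G (fsuc i))
        → ∀ i → G i ⊆ G (fromℕ k)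
⊆-fromℕ {k = zero}  G G⊆ fzero    = id
⊆-fromℕ {k = suc k} G G⊆ fzero    = ⊆-fromℕ (G ∘ fsuc) (G⊆ ∘ fsuc) fzero ∘ G⊆ fzero
⊆-fromℕ {k = suc k} G G⊆ (fsuc i) = ⊆-fromℕ (G ∘ fsuc) (G⊆ ∘ fsuc) i

x∉p-x : ∀ {n} (p : Subset n) x → x ∉ p - x
x∉p-x (s ∷ p) (fsuc x) (there x∈p-x) = x∉p-x p x x∈p-x

p-x∪⁅x⁆≡p : ∀ {n} {p : Subset n} {x} → x ∈ p → (p - x) ∪ ⁅ x ⁆ ≡ p
p-x∪⁅x⁆≡p {p = p} {x} x∈p = ⊆-antisym ⊆p p⊆
  where
  ⊆p : (p - x) ∪ ⁅ x ⁆ ⊆ p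
  ⊆p {y} y∈ with x∈p∪q⁻ (p - x) ⁅ x ⁆ y∈
  ... | inj₁ y∈p-x = p─q⊆p p ⁅ x ⁆ y∈p-x
  ... | inj₂ y∈⁅x⁆ = subst (_∈ p) (sym (x∈⁅y⁆⇒x≡y x y∈⁅x⁆)) x∈p
  p⊆ : p ⊆ (p - x) ∪ ⁅ x ⁆
  p⊆ {y} y∈p with y ≟ x
  ... | yes refl = q⊆p∪q (p - x) ⁅ x ⁆ (x∈⁅x⁆ x)
  ... | no y≢x   = p⊆p∪q ⁅ x ⁆ (x∈p∧x≢y⇒x∈p-y y∈p y≢x)

∣p∪⁅x⁆∣≤1+∣p∣ : ∀ {n} (p : Subset n) x → ∣ p ∪ ⁅ x ⁆ ∣ ≤ suc ∣ p ∣
∣p∪⁅x⁆∣≤1+∣p∣ (inside  ∷ p) fzero    rewrite ∪-identityʳ p = n≤1+n _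
∣p∪⁅x⁆∣≤1+∣p∣ (outside ∷ p) fzero    rewrite ∪-identityʳ p = ≤-refl
∣p∪⁅x⁆∣≤1+∣p∣ (inside  ∷ p) (fsuc x) = s≤s (∣p∪⁅x⁆∣≤1+∣p∣ p x)
∣p∪⁅x⁆∣≤1+∣p∣ (outside ∷ p) (fsuc x) = ∣p∪⁅x⁆∣≤1+∣p∣ p x

∃-superset-of-size : ∀ {n} (p : Subset n) {t} → ∣ p ∣ ≤ t → t ≤ n → ∃ λ q → p ⊆ q × ∣ q ∣ ≡ t
∃-superset-of-size []            {zero}  _            _           = [] , id , refl
∃-superset-of-size (inside  ∷ p) {suc t} (s≤s ∣p∣≤t) (s≤s t≤n) =
  let q , p⊆q , ∣q∣≡t = ∃-superset-of-size p ∣p∣≤t t≤n in inside ∷ q , s⊆s p⊆q , cong suc ∣q∣≡t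
∃-superset-of-size {suc n} (outside ∷ p) {t} ∣p∣≤t t≤1+n with t ≤? n
... | yes t≤n = let q , p⊆q , ∣q∣≡t = ∃-superset-of-size p ∣p∣≤t t≤n in outside ∷ q , s⊆s p⊆q , ∣q∣≡t
... | no  t≰n = ⊤ , ⊆⊤ , trans (∣⊤∣≡n (suc n)) (≤-antisym (≰⇒> t≰n) t≤1+n)

Tr-top : ∀ {n} {ℱ : Family n} {T} → Tr ℱ T → Nonempty T →
         ∃₂ λ x G → x ∈ T × ℱ G × T - x ⊆ G × x ∉ G
Tr-top (zero , x , F , _ , onto , _) (y , y∈T) with onto y y∈T
... | () , _
Tr-top {T = T} (suc k , x , F , _ , onto , x∈T , Fℱ , F⊂ , x∈F) _ =
  x top , F (inject₁ top) , x∈T top , Fℱ (inject₁ top) , T-x⊆F , proj₂ (x∈F top)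
  where
  top = fromℕ k
  T-x⊆F : T - x top ⊆ F (inject₁ top)
  T-x⊆F {y} y∈T-x with onto y (p─q⊆p T _ y∈T-x)
  ... | i , refl with view i
  ...   | ‵fromℕ  = ⊥-elim (x∉p-x T (x top) y∈T-x)
  ...   | ‵inject₁ j =
    ⊆-fromℕ (F ∘ inject₁) (λ i → proj₁ (F⊂ (inject₁ i))) (fsuc j) (proj₁ (x∈F (inject₁ j)))

Tr-empty : ∀ {n} {ℱ : Family n} {X} → ℱ ⊤ → Empty X → Tr ℱ X
Tr-empty ℱ-⊤ X-empty = 0 , (λ ()) , (λ _ → ⊤) , (λ {}) , (λ y y∈X → ⊥-elim (X-empty (y , y∈X)))
                     , (λ ()) , (λ _ → ℱ-⊤) , (λ ()) , (λ ())

module _ {n} {ℱ : Family n} (ℱ-⊤ : ℱ ⊤) (ℱ-∩ : ∀ {A B} → ℱ A → ℱ B → ℱ (A ∩ B)) where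

  ∈⇒flat-Tr : ∀ {X} → ℱ X → IsFlat (Tr ℱ) X
  ∈⇒flat-Tr {X} ℱX I (k , x , F , x-inj , onto , x∈I , Fℱ , F⊂ , x∈F) I⊆X p p∉X =
    suc k , x′ , F′ , x′-inj , onto′ , x′∈ , F′ℱ , F′⊂ , x′∈F′
    where
    x′ = x ∷ʳ p
    F′ = (λ j → F j ∩ X) ∷ʳ ⊤

    x∈X : ∀ i → x i ∈ X
    x∈X i = I⊆X (x∈I i)
    p≢x : ∀ i → p ≢ x i
    p≢x i p≡xi = p∉X (subst (_∈ X) (sym p≡xi) (x∈X i))

    x′-inj : ∀ {a b} → x′ a ≡ x′ b → a ≡ b
    x′-inj {a} {b} e with view a | view b
    ... | ‵fromℕ     | ‵fromℕ     = refl
    ... | ‵fromℕ     | ‵inject₁ j =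
      ⊥-elim (p≢x j (trans (sym (∷ʳ-fromℕ x p)) (trans e (∷ʳ-inject₁ x p j))))
    ... | ‵inject₁ i | ‵fromℕ     =
      ⊥-elim (p≢x i (trans (sym (∷ʳ-fromℕ x p)) (trans (sym e) (∷ʳ-inject₁ x p i))))
    ... | ‵inject₁ i | ‵inject₁ j =
      cong inject₁ (x-inj (trans (sym (∷ʳ-inject₁ x p i)) (trans e (∷ʳ-inject₁ x p j))))

    onto′ : ∀ y → y ∈ I ∪ ⁅ p ⁆ → ∃ λ i → x′ i ≡ y
    onto′ y y∈ with x∈p∪q⁻ I ⁅ p ⁆ y∈
    ... | inj₁ y∈I = let i , xi≡y = onto y y∈I in inject₁ i , trans (∷ʳ-inject₁ x p i) xi≡y
    ... | inj₂ y∈⁅p⁆ = fromℕ k , trans (∷ʳ-fromℕ x p) (sym (x∈⁅y⁆⇒x≡y p y∈⁅p⁆))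

    x′∈ : ∀ i → x′ i ∈ I ∪ ⁅ p ⁆
    x′∈ i with view i
    ... | ‵fromℕ     rewrite ∷ʳ-fromℕ x p     = q⊆p∪q I ⁅ p ⁆ (x∈⁅x⁆ p)
    ... | ‵inject₁ j rewrite ∷ʳ-inject₁ x p j = p⊆p∪q ⁅ p ⁆ (x∈I j)

    F′-inject₁ : ∀ j → F′ (inject₁ j) ≡ F j ∩ X
    F′-inject₁ = ∷ʳ-inject₁ (λ j → F j ∩ X) ⊤
    F′-fromℕ : F′ (fromℕ (suc k)) ≡ ⊤
    F′-fromℕ = ∷ʳ-fromℕ (λ j → F j ∩ X) ⊤

    F′ℱ : ∀ j → ℱ (F′ j)
    F′ℱ j with view j
    ... | ‵fromℕ     rewrite F′-fromℕ     = ℱ-⊤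
    ... | ‵inject₁ i rewrite F′-inject₁ i = ℱ-∩ (Fℱ i) ℱX

    p∉F∩X : ∀ j → p ∉ F j ∩ X
    p∉F∩X j = p∉X ∘ proj₂ ∘ x∈p∩q⁻ (F j) X

    xj∉F∩X : ∀ j → x j ∉ F (inject₁ j) ∩ X
    xj∉F∩X j = proj₂ (x∈F j) ∘ proj₁ ∘ x∈p∩q⁻ (F (inject₁ j)) X

    xj∈F∩X : ∀ j → x j ∈ F (fsuc j) ∩ X
    xj∈F∩X j = x∈p∩q⁺ (proj₁ (x∈F j) , x∈X j)

    F′⊂ : ∀ i → F′ (inject₁ i) ⊂ F′ (fsuc i)
    F′⊂ i with view i
    ... | ‵fromℕ rewrite F′-inject₁ (fromℕ k) | F′-fromℕ = ⊆⊤ , p , ∈⊤ , p∉F∩X (fromℕ k)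
    ... | ‵inject₁ j rewrite F′-inject₁ (inject₁ j) | F′-inject₁ (fsuc j) =
      (λ y∈ → let y∈F , y∈X = x∈p∩q⁻ _ X y∈ in x∈p∩q⁺ (proj₁ (F⊂ j) y∈F , y∈X)) ,
      x j , xj∈F∩X j , xj∉F∩X j

    x′∈F′ : ∀ i → x′ i ∈ F′ (fsuc i) × x′ i ∉ F′ (inject₁ i)
    x′∈F′ i with view i
    ... | ‵fromℕ rewrite F′-inject₁ (fromℕ k) | F′-fromℕ | ∷ʳ-fromℕ x p = ∈⊤ , p∉F∩X (fromℕ k)
    ... | ‵inject₁ j rewrite F′-inject₁ (inject₁ j) | F′-inject₁ (fsuc j) | ∷ʳ-inject₁ x p j =
      xj∈F∩X j , xj∉F∩X j

  Tr-of-size≤ : ∀ b → (∀ Z → ∣ Z ∣ < b → ℱ Z) → ∀ Y → ∣ Y ∣ ≤ b → Tr ℱ Y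
  Tr-of-size≤ zero    _       Y ∣Y∣≤0 =
    Tr-empty {ℱ = ℱ} ℱ-⊤ λ (v , v∈Y) → n≮0 (<-≤-trans (x∈p⇒∣p-x∣<∣p∣ v∈Y) ∣Y∣≤0)
  Tr-of-size≤ (suc b) ℱ-small Y ∣Y∣≤1+b with nonempty? Y
  ... | no  Y-empty   = Tr-empty {ℱ = ℱ} ℱ-⊤ Y-empty
  ... | yes (v , v∈Y) = subst (Tr ℱ) (p-x∪⁅x⁆≡p v∈Y)
          (∈⇒flat-Tr (ℱ-small (Y - v) ∣Y-v∣<1+b) (Y - v) Tr-Y-v id v (x∉p-x Y v))
    where
    ∣Y-v∣<1+b : ∣ Y - v ∣ < suc b
    ∣Y-v∣<1+b = <-≤-trans (x∈p⇒∣p-x∣<∣p∣ v∈Y) ∣Y∣≤1+b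
    Tr-Y-v : Tr ℱ (Y - v)
    Tr-Y-v = Tr-of-size≤ b (λ Z ∣Z∣<b → ℱ-small Z (≤-trans ∣Z∣<b (n≤1+n b))) (Y - v) (≤-pred ∣Y-v∣<1+b)

module _ {m} (S : SimplicialComplex m) (d : ℕ) where

  ε-⊤ : ε S d ⊤
  ε-⊤ _ _ _ _ p p∉⊤ = ⊥-elim (p∉⊤ ∈⊤)

  ε-∩ : ∀ {A B} → ε S d A → ε S d B → ε S d (A ∩ B)
  ε-∩ {A} {B} εA εB Y Y∈H Y⊆A∩B ∣Y∣≤d p p∉A∩B with p ∈? A | p ∈? B
  ... | yes p∈A | yes p∈B = ⊥-elim (p∉A∩B (x∈p∩q⁺ (p∈A , p∈B)))
  ... | no  p∉A | _       = εA Y Y∈H (proj₁ ∘ x∈p∩q⁻ A B ∘ Y⊆A∩B) ∣Y∣≤d p p∉A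
  ... | yes _   | no  p∉B = εB Y Y∈H (proj₂ ∘ x∈p∩q⁻ A B ∘ Y⊆A∩B) ∣Y∣≤d p p∉B

  module _ (paving : IsPaving S d) (d≤n : d ≤ suc m) where

    face-of-size≤ : ∀ Z → ∣ Z ∣ ≤ d → H S Z
    face-of-size≤ Z ∣Z∣≤d =
      let W , Z⊆W , ∣W∣≡d = ∃-superset-of-size Z ∣Z∣≤d d≤n in downClosed S Z⊆W (paving W ∣W∣≡d)

    ε-of-size< : ∀ Z → ∣ Z ∣ < d → ε S d Z
    ε-of-size< Z ∣Z∣<d Y _ Y⊆Z _ p _ =
      face-of-size≤ (Y ∪ ⁅ p ⁆) (≤-trans (∣p∪⁅x⁆∣≤1+∣p∣ Y p) (≤-trans (s≤s (p⊆q⇒∣p∣≤∣q∣ Y⊆Z)) ∣Z∣<d))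

    Tr-ε-of-size≤ : ∀ Y → ∣ Y ∣ ≤ d → Hε S d Y
    Tr-ε-of-size≤ = Tr-of-size≤ ε-⊤ ε-∩ d ε-of-size<

    Tr-ε⇒face : ∀ T → Hε S d T → ∣ T ∣ ≤ suc d → H S T
    Tr-ε⇒face T T∈Tr ∣T∣≤1+d with nonempty? T
    ... | no  T-empty = downClosed S (λ {y} y∈T → ⊥-elim (T-empty (y , y∈T))) (singleton S fzero)
    ... | yes T-ne =
      let x , G , x∈T , εG , T-x⊆G , x∉G = Tr-top {ℱ = ε S d} T∈Tr T-ne
          ∣T-x∣≤d = ≤-pred (<-≤-trans (x∈p⇒∣p-x∣<∣p∣ x∈T) ∣T∣≤1+d)
      in subst (H S) (p-x∪⁅x⁆≡p x∈T) (εG (T - x) (face-of-size≤ _ ∣T-x∣≤d) T-x⊆G ∣T-x∣≤d x x∉G)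

proposition3p7 : ∀ {m : ℕ} (S : SimplicialComplex m) (d : ℕ)
                 → HasDimension S d → IsPaving S d
                 → ∀ (X : Subset _) → IsFlat (Hε S d) X ⇔ ε S d X
proposition3p7 {m} S d ((I , _ , ∣I∣≡1+d) , _) paving X = mk⇔ flat⇒ε (∈⇒flat-Tr (ε-⊤ S d) (ε-∩ S d))
  where
  d≤n : d ≤ suc m
  d≤n = ≤-trans (n≤1+n d) (subst (_≤ suc m) ∣I∣≡1+d (∣p∣≤n I))

  flat⇒ε : IsFlat (Hε S d) X → ε S d X
  -- Y need not be a face: every set of size ≤ d already lies in Tr ε(S).
  flat⇒ε X-flat Y _ Y⊆X ∣Y∣≤d p p∉X =
    Tr-ε⇒face S d paving d≤n (Y ∪ ⁅ p ⁆)
      (X-flat Y (Tr-ε-of-size≤ S d paving d≤n Y ∣Y∣≤d) Y⊆X p p∉X)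
      (≤-trans (∣p∪⁅x⁆∣≤1+∣p∣ Y p) (s≤s ∣Y∣≤d))
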